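{- Let $\mu=(1^{m_1}2^{m_2}\cdots)$ and $\nu$ be partitions of $n$, let $g\in\frac12\mathbb Z$ be such that $k=2g-2+\ell(\mu)+\ell(\nu)$ is a nonnegative integer, and define $$H^{\le,\bullet}_g\!\left(\begin{smallmatrix}\nu\\ \mu\end{smallmatrix}\right)=\frac{1}{\prod_j(2jC)^{m_j}m_j!}\,[\mathcal D_\mu].\,\mathrm h_k(\mathbf X_2,\dots,\mathbf X_n)\big(J^{ -\ell(\nu)}\mathcal D_\nu\big).$$ Then $H^{\le,\bullet}_g\!\left(\begin{smallmatrix}\nu\\ \mu\end{smallmatrix}\right)=\big\langle\mathcal D_\mu,\ \mathrm h_k(\mathbb X_2,\dots,\mathbb X_n)(\mathcal D_\nu)\big\rangle$.
   Context: $\mathrm h_k$ is the complete homogeneous symmetric function; $\ell$ is number of parts. Let $[\bar n]=\{1,\bar 1,\dots,n,\bar n\}$ with the total order $1<\bar 1<\cdots<n<\bar n$, $S_{2n}$ the symmetric group on $[\bar n]$, $\tau=(1\ \bar1)\cdots(n\ \bar n)$. The type of a fixed-point-free involution $\rho$ is the partition $\lambda\vdash n$ such that the connected components of the graph on $[\bar n]$ with edges $\{x,\rho(x)\},\{x,\tau(x)\}$ have $2\lambda_1,\dots,2\lambda_\ell$ vertices; $d_\lambda$ is the set of such involutions, $\mathcal D_\lambda=\sum_{\rho\in d_\lambda}\rho$ in the $\mathbb C(C,J,T)$-vector space $M_n(C,J,T)$ with basis the fixed-point-free involutions ($C,J,T$ indeterminates), and $I_n(C,J,T)=\mathrm{span}\{\mathcal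 D_\lambda\}$. With $\sigma.\rho=\sigma\rho\sigma^{ -1}$, a transposition $\sigma$ makes a cut (resp. join, twist) for $\rho$ if the type of $\sigma.\rho$ has one more part (resp. one fewer part, the same type) than that of $\rho$. The operator $\mathbf X_k$ on $M_n(C,J,T)$ is $\mathbf X_k(\rho)=\sum_{j\in[\bar n],\,j<k}w(\rho,(j\ k))\,(j\ k).\rho$ with weight $w=C$ for a cut, $J$ for a join, $T$ for a twist; the refined Jucys–Murphy element $\mathbb X_k$ is defined by the same formula with weight $1$ for a cut, $CJ$ for a join and $T$ for a twist (i.e. $\mathbf X_k$ with $J\mapsto1$, $C\mapsto CJ$). Symmetric functions of $\mathbf X_2,\dots,\mathbf X_n$ (resp. $\mathbb X_2,\dots,\mathbb X_n$) applied to $\mathcal D_\nu$ are well defined and lie in $I_n(C,J,T)$; $[\mathcal D_\mu].v$ is the coefficient of $\mathcal D_\mu$ in $v$. The refined inner product is the $\mathbb C(C,J,T)$-bilinear form on $I_n(C,J,T)$ with $\langle\mathcal D_\lambda,\mathcal D_\mu\rangle=\delta_{\lambda,\mu}\prod_{j\ge1}\frac{1}{(2jCJ)^{m_j}m_j!}$ for $\lambda=(1^{m_1}2^{m_2}\cdots)$. -}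

module Defs where

open import Level using (Level)
open import Data.Nat as ℕ using (ℕ; zero; suc; _≥_; _<_; _/_; _!)
open import Data.Nat.Properties using (≤-decTotalOrder)
open import Data.Nat.ListAction using (sum)
open import Data.Bool.ListAction using (all; any)
open import Data.Fin as Fin using (Fin; toℕ)
open import Data.Bool using (Bool; true; false; if_then_else_; _∧_; _∨_; not)
import Data.Bool as Bool
open import Data.Product using (_×_; _,_; proj₁; proj₂)
import Data.Product.Properties as ×P
open import Data.List as List using (List; []; _∷_; _++_; map; concatMap; filter; length; foldr; reverse)
import Data.List.Properties as LP
open import Data.List.Relation.Unary.All using (All)
open import Data.List.Relation.Unary.Linked using (Linked)
open import Data.List.Sort.InsertionSort ≤-decTotalOrder using (sort)
open import Relation.Binary.PropositionalEquality using (_≡_; _≢_)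
open import Relation.Binary.Definitions using (DecidableEquality)
open import Relation.Nullary.Decidable using (⌊_⌋)
open import Algebra.Bundles using (CommutativeRing)

IsPartition : ℕ → List ℕ → Set
IsPartition n λ′ = Linked _≥_ λ′ × All (λ p → 0 < p) λ′ × sum λ′ ≡ n

mult : ℕ → List ℕ → ℕ
mult j λ′ = length (filter (λ p → p ℕ.≟ j) λ′)

-- The set [n̄] = {1, 1̄, …, n, n̄}.  The element (i , false) is i+1 and
-- (i , true) is the barred element (i+1)‾ .

V : ℕ → Set
V n = Fin n × Bool

_≟V_ : ∀ {n} → DecidableEquality (V n)
_≟V_ = ×P.≡-dec Fin._≟_ Bool._≟_

_<V_ : ∀ {n} → V n → V n → Bool
(a , b) <V (a′ , b′) =
  ⌊ toℕ a ℕ.<? toℕ a′ ⌋ ∨ (⌊ a Fin.≟ a′ ⌋ ∧ (not b ∧ b′))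

allV : (n : ℕ) → List (V n)
allV n = concatMap (λ i → (i , false) ∷ (i , true) ∷ []) (List.allFin n)

-- the unbarred element k (1 ≤ k ≤ n), given by i = k - 1 : Fin n
unbarred : ∀ {n} → Fin n → V n
unbarred i = (i , false)

Map : ℕ → Set
Map n = V n → V n

τ : ∀ {n} → Map n
τ (i , b) = (i , not b)

transp : ∀ {n} → V n → V n → Map n
transp j k x =
  if ⌊ x ≟V j ⌋ then k else (if ⌊ x ≟V k ⌋ then j else x)

-- σ.ρ = σ ρ σ⁻¹ for a transposition σ = (j k) (σ⁻¹ = σ)
conjT : ∀ {n} → V n → V n → Map n → Map n
conjT j k ρ x = transp j k (ρ (transp j k x))

IsFPFInvolution : ∀ {n} → Map n → Set
IsFPFInvolution ρ = ∀ x → ρ (ρ x) ≡ x × ρ x ≢ x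

isFPFInv? : ∀ {n} → Map n → Bool
isFPFInv? {n} ρ = all (λ x → ⌊ ρ (ρ x) ≟V x ⌋ ∧ not ⌊ ρ x ≟V x ⌋) (allV n)

adj : ∀ {n} → Map n → V n → V n → Bool
adj ρ z y = ⌊ ρ z ≟V y ⌋ ∨ ⌊ τ z ≟V y ⌋ ∨ ⌊ ρ y ≟V z ⌋ ∨ ⌊ τ y ≟V z ⌋

reach : ∀ {n} → Map n → ℕ → V n → V n → Bool
reach ρ zero x y = ⌊ x ≟V y ⌋
reach {n} ρ (suc s) x y =
  reach ρ s x y ∨ any (λ z → reach ρ s x z ∧ adj ρ z y) (allV n)

-- x and y are in the same connected component (paths of length ≤ 2n suffice)
connected : ∀ {n} → Map n → V n → V n → Bool
connected {n} ρ = reach ρ (2 ℕ.* n)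

compSize : ∀ {n} → Map n → V n → ℕ
compSize {n} ρ x = length (filter (λ y → Bool.T? (connected ρ x y)) (allV n))

isRep : ∀ {n} → Map n → V n → Bool
isRep {n} ρ x = not (any (λ y → connected ρ x y ∧ (y <V x)) (allV n))

typeOf : ∀ {n} → Map n → List ℕ
typeOf {n} ρ =
  reverse (sort (map (λ x → compSize ρ x / 2)
                     (filter (λ x → Bool.T? (isRep ρ x)) (allV n))))

_≟L_ : DecidableEquality (List ℕ)
_≟L_ = LP.≡-dec ℕ._≟_

InD : (n : ℕ) → List ℕ → Map n → Set
InD n μ ρ = IsFPFInvolution ρ × typeOf ρ ≡ μ

inD? : (n : ℕ) → List ℕ → Map n → Bool
inD? n μ ρ = isFPFInv? ρ ∧ ⌊ typeOf ρ ≟L μ ⌋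

update : ∀ {n} → Map n → V n → V n → Map n
update f x y a = if ⌊ a ≟V x ⌋ then y else f a

allMapsOn : ∀ {n} → List (V n) → List (Map n)
allMapsOn [] = (λ a → a) ∷ []
allMapsOn {n} (x ∷ xs) =
  concatMap (λ f → map (λ y → update f x y) (allV n)) (allMapsOn xs)

dList : (n : ℕ) → List ℕ → List (Map n)
dList n μ = filter (λ ρ → Bool.T? (inD? n μ ρ)) (allMapsOn (allV n))

-- the indices 2, …, n of the Jucys–Murphy elements, as unbarred elements
jmIndices : (n : ℕ) → List (V n)
jmIndices n = map unbarred (filter (λ i → 1 ℕ.≤? toℕ i) (List.allFin n))

module WithRing {c ℓ : Level} (R : CommutativeRing c ℓ) where
  open CommutativeRing R

  natR : ℕ → Carrier
  natR zero = 0#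
  natR (suc m) = 1# + natR m

  _^R_ : Carrier → ℕ → Carrier
  x ^R zero = 1#
  x ^R suc m = x * (x ^R m)

  -- vectors of M_n as formal linear combinations of basis elements
  Vect : ℕ → Set c
  Vect n = List (Carrier × Map n)

  scale : ∀ {n} → Carrier → Vect n → Vect n
  scale a = map (λ t → (a * proj₁ t , proj₂ t))

  sameMap : ∀ {n} → Map n → Map n → Bool
  sameMap {n} f g = all (λ x → ⌊ f x ≟V g x ⌋) (allV n)

  coeff : ∀ {n} → Vect n → Map n → Carrier
  coeff [] ρ = 0#
  coeff ((a , f) ∷ v) ρ = (if sameMap f ρ then a else 0#) + coeff v ρ

  𝒟 : (n : ℕ) → List ℕ → Vect n
  𝒟 n μ = map (λ ρ → (1# , ρ)) (dList n μ)

  -- weight of σ with ρ ↦ ρ′ = σ.ρ : wc for a cut, wj for a join, wt for a twist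
  weight : ∀ {n} → Carrier → Carrier → Carrier → Map n → Map n → Carrier
  weight wc wj wt ρ ρ′ =
    if ⌊ length (typeOf ρ′) ℕ.≟ suc (length (typeOf ρ)) ⌋ then wc else
    (if ⌊ suc (length (typeOf ρ′)) ℕ.≟ length (typeOf ρ) ⌋ then wj else
    (if ⌊ typeOf ρ′ ≟L typeOf ρ ⌋ then wt else 0#))

  Xop : ∀ {n} → Carrier → Carrier → Carrier → V n → Vect n → Vect n
  Xop {n} wc wj wt k =
    concatMap (λ t →
      map (λ j → ( weight wc wj wt (proj₂ t) (conjT j k (proj₂ t)) * proj₁ t
                 , conjT j k (proj₂ t)))
          (filter (λ j → Bool.T? (j <V k)) (allV n)))

  𝐗 : ∀ {n} → (C J T : Carrier) → V n → Vect n → Vect n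
  𝐗 C J T = Xop C J T

  𝕏 : ∀ {n} → (C J T : Carrier) → V n → Vect n → Vect n
  𝕏 C J T = Xop (C * J) 1# T

  -- h_k(Y₁, …, Y_r) as an operator:  h_{k+1}(Y, Ys) = h_{k+1}(Ys) + Y h_k(Y, Ys)
  hOp : ∀ {n} → ℕ → List (Vect n → Vect n) → Vect n → Vect n
  hOp zero Ys v = v
  hOp (suc k) [] v = []
  hOp (suc k) (Y ∷ Ys) v = hOp (suc k) Ys v ++ Y (hOp k (Y ∷ Ys) v)

  -- j ranges over 1, …, n (m_j = 0 for j > n when μ ⊢ n)
  prodJ : ℕ → (ℕ → Carrier) → Carrier
  prodJ n f = foldr (λ j acc → f j * acc) 1# (List.map suc (List.upTo n))

  -- 1 / ∏_j (2jC)^{m_j} m_j!   (invN m is the inverse of m·1, Cinv of C)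
  invZC : ℕ → List ℕ → Carrier → (ℕ → Carrier) → Carrier
  invZC n μ Cinv invN =
    prodJ n (λ j → ((invN (2 ℕ.* j) * Cinv) ^R mult j μ) * invN (mult j μ !))

  -- 1 / ∏_j (2jCJ)^{m_j} m_j!  = ⟨𝒟_μ, 𝒟_μ⟩
  normD : ℕ → List ℕ → Carrier → Carrier → (ℕ → Carrier) → Carrier
  normD n μ Cinv Jinv invN =
    prodJ n (λ j → ((invN (2 ℕ.* j) * (Cinv * Jinv)) ^R mult j μ) * invN (mult j μ !))

  -- [𝒟_μ].v , read off at a basis element ρ ∈ d_μ (v ∈ I_n)
  coeffD : ∀ {n} → Vect n → Map n → Carrier
  coeffD = coeff

  -- ⟨𝒟_μ, v⟩ = ⟨𝒟_μ,𝒟_μ⟩ [𝒟_μ].v  for v ∈ I_n, read off at ρ ∈ d_μ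
  innerD : (n : ℕ) → List ℕ → Carrier → Carrier → (ℕ → Carrier) → Vect n → Map n → Carrier
  innerD n μ Cinv Jinv invN v ρ = normD n μ Cinv Jinv invN * coeffD v ρ

  -- H^{≤,•}_g (ν over μ), read off at ρ ∈ d_μ, with k = 2g-2+ℓ(μ)+ℓ(ν)
  Hle : (n : ℕ) → (C J T Cinv Jinv : Carrier) → (ℕ → Carrier) →
        List ℕ → List ℕ → ℕ → Map n → Carrier
  Hle n C J T Cinv Jinv invN μ ν k ρ =
    invZC n μ Cinv invN *
    coeffD (hOp k (map (𝐗 C J T) (jmIndices n))
                  (scale (Jinv ^R length ν) (𝒟 n ν))) ρ

  -- ⟨𝒟_μ, h_k(𝕏_2, …, 𝕏_n) 𝒟_ν⟩, read off at ρ ∈ d_μ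
  Hrhs : (n : ℕ) → (C J T Cinv Jinv : Carrier) → (ℕ → Carrier) →
         List ℕ → List ℕ → ℕ → Map n → Carrier
  Hrhs n C J T Cinv Jinv invN μ ν k ρ =
    innerD n μ Cinv Jinv invN (hOp k (map (𝕏 C J T) (jmIndices n)) (𝒟 n ν)) ρ

{-# OPTIONS --safe #-}
-- The weights of 𝐗_k and 𝕏_k differ by exactly the power of J by which the number of
-- parts changes: a cut (ℓ ↦ ℓ + 1) has weight C against CJ, a join (ℓ ↦ ℓ - 1) has J
-- against 1, a twist has T against T.  Hence multiplying the coefficient of every basis
-- element ρ by J^ℓ(type ρ) intertwines each 𝐗_k with 𝕏_k, and therefore h_k(𝐗) with
-- h_k(𝕏).  This rescaling sends J^-ℓ(ν) 𝒟_ν to 𝒟_ν and multiplies the coefficient at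
-- ρ ∈ d_μ by J^ℓ(μ), which is the ratio of the two normalisations because
-- Σ_j m_j(μ) = ℓ(μ).
module Submission where

open import Defs
open import Level using (Level)
open import Data.Nat using (ℕ; suc)
open import Data.Integer using (ℤ; +_; _+_; _-_)
open import Data.List using (List; length)
open import Relation.Binary.PropositionalEquality using (_≡_)
open import Algebra.Bundles using (CommutativeRing)

open import Level using (_⊔_)
open import Data.Nat as ℕ using (zero; _<_; _≤_; s≤s)
import Data.Nat.Properties as ℕ
open import Data.Nat.ListAction using (sum)
open import Data.Bool using (Bool; true; false; T; not; _∧_; _∨_)
open import Data.Bool.Properties using (T-∧)
open import Data.Bool.ListAction using (any; or)
import Data.Bool as Bool
open import Data.Product using (_×_; _,_; proj₂)
open import Data.List as List using ([]; _∷_; [_]; map; filter; reverse; upTo)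
import Data.List.Properties as List
open import Data.List.Sort.InsertionSort ℕ.≤-decTotalOrder using (sort)
open import Data.List.Membership.Propositional using (_∈_)
open import Data.List.Membership.Propositional.Properties using (∈-allFin; ∈-map⁺; ∈-concat⁺′)
open import Data.List.Relation.Unary.Any using (here; there)
open import Data.List.Relation.Unary.All as All using (All; []; _∷_)
open import Data.List.Relation.Unary.All.Properties using (all⁺; all-filter)
open import Data.List.Relation.Binary.Pointwise using (Pointwise; []; _∷_; ++⁺)
open import Function.Base using (_∘_)
open import Function.Bundles using (Equivalence)
open import Relation.Binary.PropositionalEquality as ≡ using (refl; cong; cong₂; _≗_)
open import Relation.Nullary using (does; yes; no)
open import Relation.Nullary.Decidable using (toWitness)
open import Algebra.Properties.CommutativeSemigroup ℕ.+-commutativeSemigroup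
  using () renaming (interchange to +-interchange)

any-cong : ∀ {a} {A : Set a} {p q : A → Bool} → p ≗ q → ∀ xs → any p xs ≡ any q xs
any-cong p≗q xs = cong or (List.map-cong p≗q xs)

filter-T?-cong : ∀ {a} {A : Set a} {p q : A → Bool} → p ≗ q →
                 filter (Bool.T? ∘ p) ≗ filter (Bool.T? ∘ q)
filter-T?-cong p≗q =
  List.filter-≐ _ _ ((λ {x} → ≡.subst T (p≗q x)) , (λ {x} → ≡.subst T (≡.sym (p≗q x))))

module _ {n : ℕ} {f g : Map n} (f≗g : f ≗ g) where

  adj-cong : ∀ z y → adj f z y ≡ adj g z y
  adj-cong z y rewrite f≗g z | f≗g y = refl

  reach-cong : ∀ s x y → reach f s x y ≡ reach g s x y
  reach-cong zero    x y = refl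
  reach-cong (suc s) x y =
    cong₂ _∨_ (reach-cong s x y)
              (any-cong (λ z → cong₂ _∧_ (reach-cong s x z) (adj-cong z y)) (allV n))

  connected-cong : ∀ x y → connected f x y ≡ connected g x y
  connected-cong = reach-cong (2 ℕ.* n)

  compSize-cong : compSize f ≗ compSize g
  compSize-cong x = cong length (filter-T?-cong (connected-cong x) (allV n))

  isRep-cong : isRep f ≗ isRep g
  isRep-cong x = cong not (any-cong (λ y → cong (_∧ (y <V x)) (connected-cong x y)) (allV n))

  typeOf-cong : typeOf f ≡ typeOf g
  typeOf-cong = ≡.trans
    (cong (λ reps → reverse (sort (map (λ x → compSize f x ℕ./ 2) reps)))
          (filter-T?-cong isRep-cong (allV n)))
    (cong (reverse ∘ sort)
          (List.map-cong (cong (ℕ._/ 2) ∘ compSize-cong) (filter (Bool.T? ∘ isRep g) (allV n))))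

∈-allV : ∀ {n} (x : V n) → x ∈ allV n
∈-allV (i , b) = ∈-concat⁺′ (∈-pair b) (∈-map⁺ _ (∈-allFin i))
  where
  ∈-pair : ∀ b → (i , b) ∈ (i , false) ∷ (i , true) ∷ []
  ∈-pair false = here refl
  ∈-pair true  = there (here refl)

sameMap⇒≗ : ∀ {c ℓ} (R : CommutativeRing c ℓ) {n} {f g : Map n} →
            T (WithRing.sameMap R f g) → f ≗ g
sameMap⇒≗ R {n} same x = toWitness (All.lookup (all⁺ _ (allV n) same) (∈-allV x))

mult-∷ : ∀ j p μ → mult j (p ∷ μ) ≡ mult j [ p ] ℕ.+ mult j μ
mult-∷ j p μ with does (p ℕ.≟ j)
... | true  = refl
... | false = refl

sum-map-0 : ∀ {a} {A : Set a} (xs : List A) → sum (map (λ _ → 0) xs) ≡ 0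
sum-map-0 []       = refl
sum-map-0 (_ ∷ xs) = sum-map-0 xs

sum-map-+ : ∀ {a} {A : Set a} (f g : A → ℕ) xs →
            sum (map (λ x → f x ℕ.+ g x) xs) ≡ sum (map f xs) ℕ.+ sum (map g xs)
sum-map-+ f g []       = refl
sum-map-+ f g (x ∷ xs) =
  ≡.trans (cong (f x ℕ.+ g x ℕ.+_) (sum-map-+ f g xs)) (+-interchange (f x) (g x) _ _)

map-upTo-suc : ∀ {a} {A : Set a} (f : ℕ → A) m →
               map f (upTo (suc m)) ≡ f 0 ∷ map (f ∘ suc) (upTo m)
map-upTo-suc f m =
  cong (f 0 ∷_) (≡.trans (List.map-applyUpTo suc f m) (≡.sym (List.map-upTo (f ∘ suc) m)))

mult-[]-suc : ∀ j q → mult (suc j) [ suc q ] ≡ mult j [ q ]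
mult-[]-suc j q with q ℕ.≡ᵇ j
... | true  = refl
... | false = refl

sum-mult-[]-suc : ∀ q js →
  sum (map ((λ j → mult j [ suc q ]) ∘ suc) js) ≡ sum (map (λ j → mult j [ q ]) js)
sum-mult-[]-suc q js = cong sum (List.map-cong (λ j → mult-[]-suc j q) js)

sum-mult-[]-upTo : ∀ {q n} → q < n → sum (map (λ j → mult j [ q ]) (upTo n)) ≡ 1
sum-mult-[]-upTo {zero}  {suc m} _ =
  ≡.trans (cong sum (map-upTo-suc (λ j → mult j [ 0 ]) m)) (cong suc (sum-map-0 (upTo m)))
sum-mult-[]-upTo {suc q} {suc m} (s≤s q<m) =
  ≡.trans (cong sum (map-upTo-suc (λ j → mult j [ suc q ]) m))
          (≡.trans (sum-mult-[]-suc q (upTo m)) (sum-mult-[]-upTo q<m))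

sum-mult-upTo : ∀ {n} μ → All (0 <_) μ → sum μ ≤ n →
                sum (map (λ j → mult j μ) (map suc (upTo n))) ≡ length μ
sum-mult-upTo {n} []      _             _      = sum-map-0 (map suc (upTo n))
sum-mult-upTo {n} (p ∷ μ) (0<p ∷ 0<μ) Σ≤n = begin
  sum (map (λ j → mult j (p ∷ μ)) js)
    ≡⟨ cong sum (List.map-cong (λ j → mult-∷ j p μ) js) ⟩
  sum (map (λ j → mult j [ p ] ℕ.+ mult j μ) js)
    ≡⟨ sum-map-+ (λ j → mult j [ p ]) (λ j → mult j μ) js ⟩
  sum (map (λ j → mult j [ p ]) js) ℕ.+ sum (map (λ j → mult j μ) js)
    ≡⟨ cong₂ ℕ._+_ (sum-mult-[]-positive 0<p (ℕ.≤-trans (ℕ.m≤m+n p (sum μ)) Σ≤n))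
                   (sum-mult-upTo μ 0<μ (ℕ.≤-trans (ℕ.m≤n+m (sum μ) p) Σ≤n)) ⟩
  suc (length μ) ∎
  where
  open ≡.≡-Reasoning
  js = map suc (upTo n)
  sum-mult-[]-positive : ∀ {p} → 0 < p → p ≤ n → sum (map (λ j → mult j [ p ]) js) ≡ 1
  sum-mult-[]-positive {suc q} _ q<n =
    ≡.trans (cong sum (≡.sym (List.map-∘ (upTo n))))
            (≡.trans (sum-mult-[]-suc q (upTo n)) (sum-mult-[]-upTo q<n))

dList-typeOf : ∀ n ν → All (λ ρ → typeOf ρ ≡ ν) (dList n ν)
dList-typeOf n ν =
  All.map (λ {ρ} ρ∈d → toWitness (proj₂ (Equivalence.to (T-∧ {isFPFInv? ρ}) ρ∈d)))
          (all-filter (Bool.T? ∘ inD? n ν) (allMapsOn (allV n)))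

module _ {c ℓ : Level} (R : CommutativeRing c ℓ) where
  open CommutativeRing R renaming (refl to ≈-refl)
  open WithRing R
  open import Algebra.Properties.CommutativeSemiring.Exp commutativeSemiring
    using (_^_; ^-congˡ; ^-homo-*; ^-distrib-*)
  open import Algebra.Properties.CommutativeSemigroup *-commutativeSemigroup
    using (interchange; x∙yz≈y∙xz; xy∙z≈xz∙y)
  open import Relation.Binary.Reasoning.Setoid setoid

  ^R≡^ : ∀ x m → x ^R m ≡ x ^ m
  ^R≡^ x zero    = refl
  ^R≡^ x (suc m) = cong (x *_) (^R≡^ x m)

  ^R-congˡ : ∀ {x y} m → x ≈ y → x ^R m ≈ y ^R m
  ^R-congˡ {x} {y} m x≈y rewrite ^R≡^ x m | ^R≡^ y m = ^-congˡ m x≈y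

  ^R-homo-* : ∀ x m n → x ^R (m ℕ.+ n) ≈ x ^R m * x ^R n
  ^R-homo-* x m n rewrite ^R≡^ x (m ℕ.+ n) | ^R≡^ x m | ^R≡^ x n = ^-homo-* x m n

  ^R-distrib-* : ∀ x y m → (x * y) ^R m ≈ x ^R m * y ^R m
  ^R-distrib-* x y m rewrite ^R≡^ (x * y) m | ^R≡^ x m | ^R≡^ y m = ^-distrib-* x y m

  ^R-inverse : ∀ {x y} → x * y ≈ 1# → ∀ m → x ^R m * y ^R m ≈ 1#
  ^R-inverse x*y≈1 zero    = *-identityˡ 1#
  ^R-inverse {x} {y} x*y≈1 (suc m) = begin
    (x * x ^R m) * (y * y ^R m) ≈⟨ interchange x _ y _ ⟩
    (x * y) * (x ^R m * y ^R m) ≈⟨ *-cong x*y≈1 (^R-inverse x*y≈1 m) ⟩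
    1# * 1#                     ≈⟨ *-identityˡ 1# ⟩
    1#                          ∎

  ∏ : List ℕ → (ℕ → Carrier) → Carrier
  ∏ js f = List.foldr (λ j acc → f j * acc) 1# js

  ∏-factor-^R : ∀ x {G H : ℕ → Carrier} (m : ℕ → ℕ) → (∀ j → G j ≈ H j * x ^R m j) →
                ∀ js → ∏ js G ≈ ∏ js H * x ^R sum (map m js)
  ∏-factor-^R x m G≈H*x^m []       = sym (*-identityˡ 1#)
  ∏-factor-^R x {G} {H} m G≈H*x^m (j ∷ js) = begin
    G j * ∏ js G                             ≈⟨ *-cong (G≈H*x^m j) (∏-factor-^R x m G≈H*x^m js) ⟩
    (H j * x ^R m j) * (∏ js H * x ^R s)     ≈⟨ interchange (H j) _ (∏ js H) _ ⟩
    (H j * ∏ js H) * (x ^R m j * x ^R s)     ≈⟨ *-congˡ (sym (^R-homo-* x (m j) s)) ⟩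
    (H j * ∏ js H) * x ^R (m j ℕ.+ s)        ∎
    where
    s : ℕ
    s = sum (map m js)

  normD≈invZC*Jinv^ℓ : ∀ n μ Cinv Jinv invN → All (0 <_) μ → sum μ ≤ n →
    normD n μ Cinv Jinv invN ≈ invZC n μ Cinv invN * Jinv ^R length μ
  normD≈invZC*Jinv^ℓ n μ Cinv Jinv invN μ-pos Σμ≤n = begin
    normD n μ Cinv Jinv invN
      ≈⟨ ∏-factor-^R Jinv (λ j → mult j μ) factor (map suc (upTo n)) ⟩
    invZC n μ Cinv invN * Jinv ^R sum (map (λ j → mult j μ) (map suc (upTo n)))
      ≡⟨ cong (λ e → invZC n μ Cinv invN * Jinv ^R e) (sum-mult-upTo μ μ-pos Σμ≤n) ⟩
    invZC n μ Cinv invN * Jinv ^R length μ ∎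
    where
    factor : ∀ j → ((invN (2 ℕ.* j) * (Cinv * Jinv)) ^R mult j μ) * invN (mult j μ ℕ.!)
                 ≈ (((invN (2 ℕ.* j) * Cinv) ^R mult j μ) * invN (mult j μ ℕ.!)) * Jinv ^R mult j μ
    factor j = begin
      ((i * (Cinv * Jinv)) ^R m) * f      ≈⟨ *-congʳ (^R-congˡ m (sym (*-assoc i Cinv Jinv))) ⟩
      (((i * Cinv) * Jinv) ^R m) * f      ≈⟨ *-congʳ (^R-distrib-* (i * Cinv) Jinv m) ⟩
      ((i * Cinv) ^R m * Jinv ^R m) * f   ≈⟨ xy∙z≈xz∙y _ _ f ⟩
      ((i * Cinv) ^R m * f) * Jinv ^R m   ∎
      where
      i f : Carrier
      i = invN (2 ℕ.* j)
      f = invN (mult j μ ℕ.!)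
      m : ℕ
      m = mult j μ

  module Rescaling (x : Carrier) where

    parts : ∀ {n} → Map n → ℕ
    parts ρ = length (typeOf ρ)

    _∼_ : ∀ {n} → Carrier × Map n → Carrier × Map n → Set ℓ
    (a , f) ∼ (b , g) = f ≡ g × a * x ^R parts f ≈ b

    Rescaled : ∀ {n} → Vect n → Vect n → Set (c ⊔ ℓ)
    Rescaled = Pointwise _∼_

    map-rescaled : ∀ {a n} {A : Set a} {F G : A → Carrier × Map n} →
                   (∀ j → F j ∼ G j) → ∀ js → Rescaled (map F js) (map G js)
    map-rescaled F∼G []       = []
    map-rescaled F∼G (j ∷ js) = F∼G j ∷ map-rescaled F∼G js

    module _ {wc wj wt wc′ wj′ wt′ : Carrier}
             (cut : wc * x ≈ wc′) (join : wj ≈ wj′ * x) (twist : wt ≈ wt′) where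

      weight-rescaled : ∀ {n} (f f′ : Map n) {a b} → a * x ^R parts f ≈ b →
        (weight wc wj wt f f′ * a) * x ^R parts f′ ≈ weight wc′ wj′ wt′ f f′ * b
      weight-rescaled f f′ {a} {b} e with parts f′ ℕ.≟ suc (parts f)
      ... | yes ℓ′≡1+ℓ = begin
        (wc * a) * x ^R parts f′          ≡⟨ cong (λ l → (wc * a) * x ^R l) ℓ′≡1+ℓ ⟩
        (wc * a) * (x * x ^R parts f)     ≈⟨ interchange wc a x _ ⟩
        (wc * x) * (a * x ^R parts f)     ≈⟨ *-cong cut e ⟩
        wc′ * b                           ∎
      ... | no _ with suc (parts f′) ℕ.≟ parts f
      ...   | yes 1+ℓ′≡ℓ = begin
        (wj * a) * x ^R parts f′          ≈⟨ *-congʳ (*-congʳ join) ⟩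
        ((wj′ * x) * a) * x ^R parts f′   ≈⟨ *-assoc _ a _ ⟩
        (wj′ * x) * (a * x ^R parts f′)   ≈⟨ *-assoc wj′ x _ ⟩
        wj′ * (x * (a * x ^R parts f′))   ≈⟨ *-congˡ (x∙yz≈y∙xz x a _) ⟩
        wj′ * (a * x ^R suc (parts f′))   ≡⟨ cong (λ l → wj′ * (a * x ^R l)) 1+ℓ′≡ℓ ⟩
        wj′ * (a * x ^R parts f)          ≈⟨ *-congˡ e ⟩
        wj′ * b                           ∎
      ...   | no _ with typeOf f′ ≟L typeOf f
      ...     | yes type≡ = begin
        (wt * a) * x ^R parts f′          ≈⟨ *-assoc wt a _ ⟩
        wt * (a * x ^R parts f′)          ≡⟨ cong (λ t → wt * (a * x ^R length t)) type≡ ⟩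
        wt * (a * x ^R parts f)           ≈⟨ *-cong twist e ⟩
        wt′ * b                           ∎
      ...     | no _ = begin
        (0# * a) * x ^R parts f′          ≈⟨ *-congʳ (zeroˡ a) ⟩
        0# * x ^R parts f′                ≈⟨ zeroˡ _ ⟩
        0#                                ≈⟨ sym (zeroˡ b) ⟩
        0# * b                            ∎

      Xop-rescaled : ∀ {n} (k : V n) {v w} → Rescaled v w →
                     Rescaled (Xop wc wj wt k v) (Xop wc′ wj′ wt′ k w)
      Xop-rescaled k []                        = []
      Xop-rescaled k {(a , f) ∷ _} ((refl , e) ∷ r) =
        ++⁺ (map-rescaled (λ j → refl , weight-rescaled f (conjT j k f) e) _) (Xop-rescaled k r)

    hOp-rescaled : ∀ {n} {X X′ : V n → Vect n → Vect n} →
                   (∀ i {v w} → Rescaled v w → Rescaled (X i v) (X′ i w)) →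
                   ∀ k is {v w} → Rescaled v w → Rescaled (hOp k (map X is) v) (hOp k (map X′ is) w)
    hOp-rescaled X∼X′ zero    is       r = r
    hOp-rescaled X∼X′ (suc k) []       r = []
    hOp-rescaled X∼X′ (suc k) (i ∷ is) r =
      ++⁺ (hOp-rescaled X∼X′ (suc k) is r) (X∼X′ i (hOp-rescaled X∼X′ k (i ∷ is) r))

    coeff-rescaled : ∀ {n} {v w : Vect n} → Rescaled v w →
                     ∀ ρ → coeff v ρ * x ^R parts ρ ≈ coeff w ρ
    coeff-rescaled [] ρ = zeroˡ _
    coeff-rescaled {v = (a , f) ∷ v} {(b , _) ∷ w} ((refl , e) ∷ r) ρ
      with sameMap f ρ | sameMap⇒≗ R {f = f} {ρ}
    ... | true  | f≗ρ = trans (distribʳ _ a _) (+-cong a*x^ℓρ≈b (coeff-rescaled r ρ))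
      where
      a*x^ℓρ≈b : a * x ^R parts ρ ≈ b
      a*x^ℓρ≈b = ≡.subst (λ l → a * x ^R l ≈ b) (cong length (typeOf-cong (f≗ρ _))) e
    ... | false | _   =
      trans (*-congʳ (+-identityˡ _)) (trans (coeff-rescaled r ρ) (sym (+-identityˡ _)))

    scale-rescaled : ∀ {n y m} {fs : List (Map n)} → y * x ≈ 1# → All (λ f → parts f ≡ m) fs →
                     Rescaled (scale (y ^R m) (map (1# ,_) fs)) (map (1# ,_) fs)
    scale-rescaled y*x≈1 []                = []
    scale-rescaled {y = y} {m} y*x≈1 (refl ∷ ps) =
      (refl , trans (*-congʳ (*-identityʳ _)) (^R-inverse y*x≈1 m)) ∷ scale-rescaled y*x≈1 ps

lemma4p10 : {c ℓ : Level} (R : CommutativeRing c ℓ) →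
    (C J T Cinv Jinv : CommutativeRing.Carrier R) →
    (invN : ℕ → CommutativeRing.Carrier R) →
    (∀ m → CommutativeRing._≈_ R
             (CommutativeRing._*_ R (WithRing.natR R (suc m)) (invN (suc m)))
             (CommutativeRing.1# R)) →
    CommutativeRing._≈_ R (CommutativeRing._*_ R C Cinv) (CommutativeRing.1# R) →
    CommutativeRing._≈_ R (CommutativeRing._*_ R J Jinv) (CommutativeRing.1# R) →
    (n : ℕ) (μ ν : List ℕ) → IsPartition n μ → IsPartition n ν →
    (twoG : ℤ) (k : ℕ) →
    twoG - + 2 + + length μ + + length ν ≡ + k →
    (ρ : Map n) → InD n μ ρ →
    CommutativeRing._≈_ R
      (WithRing.Hle R n C J T Cinv Jinv invN μ ν k ρ)
      (WithRing.Hrhs R n C J T Cinv Jinv invN μ ν k ρ)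
lemma4p10 R C J T Cinv Jinv invN _ _ J*Jinv≈1 n μ ν (_ , μ-pos , Σμ≡n) _ _ k _ ρ (_ , ρ-type) =
  begin
    Z * coeff v𝐗 ρ                                 ≈⟨ sym (*-identityʳ _) ⟩
    (Z * coeff v𝐗 ρ) * 1#                          ≈⟨ *-congˡ (sym (^R-inverse R Jinv*J≈1 ℓμ)) ⟩
    (Z * coeff v𝐗 ρ) * (Jinv ^R ℓμ * J ^R ℓμ)      ≈⟨ interchange Z _ _ _ ⟩
    (Z * Jinv ^R ℓμ) * (coeff v𝐗 ρ * J ^R ℓμ)      ≈⟨ *-cong (sym normD≈) coeff-v𝐗≈coeff-v𝕏 ⟩
    normD n μ Cinv Jinv invN * coeff v𝕏 ρ          ∎
  where
  open CommutativeRing R renaming (refl to ≈-refl)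
  open WithRing R
  open Rescaling R J
  open import Algebra.Properties.CommutativeSemigroup *-commutativeSemigroup using (interchange)
  open import Relation.Binary.Reasoning.Setoid setoid

  ℓμ : ℕ
  ℓμ = length μ
  Z : Carrier
  Z = invZC n μ Cinv invN
  v𝐗 : Vect n
  v𝐗 = hOp k (map (𝐗 C J T) (jmIndices n)) (scale (Jinv ^R length ν) (𝒟 n ν))
  v𝕏 : Vect n
  v𝕏 = hOp k (map (𝕏 C J T) (jmIndices n)) (𝒟 n ν)

  Jinv*J≈1 : Jinv * J ≈ 1#
  Jinv*J≈1 = trans (*-comm Jinv J) J*Jinv≈1

  normD≈ : normD n μ Cinv Jinv invN ≈ Z * Jinv ^R ℓμ
  normD≈ = normD≈invZC*Jinv^ℓ R n μ Cinv Jinv invN μ-pos (ℕ.≤-reflexive Σμ≡n)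

  v𝐗-rescaled-v𝕏 : Rescaled v𝐗 v𝕏
  v𝐗-rescaled-v𝕏 =
    hOp-rescaled (Xop-rescaled ≈-refl (sym (*-identityˡ J)) ≈-refl) k (jmIndices n)
                 (scale-rescaled Jinv*J≈1 (All.map (cong length) (dList-typeOf n ν)))

  coeff-v𝐗≈coeff-v𝕏 : coeff v𝐗 ρ * J ^R ℓμ ≈ coeff v𝕏 ρ
  coeff-v𝐗≈coeff-v𝕏 =
    ≡.subst (λ l → coeff v𝐗 ρ * J ^R l ≈ coeff v𝕏 ρ) (cong length ρ-type)
            (coeff-rescaled v𝐗-rescaled-v𝕏 ρ)
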